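{- Let $H$ be a topological minor of a graph $G$. If the Tseitin-formula $T(G,0)$ has a DNNF of size $s$, then $T(H,0)$ has a DNNF of size at most $s$.
   Context: $0$ denotes the charge function that is identically $0$. For a graph $G$, $T(G,0)$ has variables $x_e$ ($e\in E(G)$) and is the conjunction over $v\in V(G)$ of $\sum_{e\in E(v)}x_e\equiv 0\pmod 2$, where $E(v)$ is the set of edges incident to $v$. A topological minor of $G$ is any graph obtained from $G$ by iteratively applying: deletion of an edge; deletion of an isolated vertex; or, for a vertex $v$ of degree $2$, deleting $v$ and joining its two neighbors by an edge. A DNNF is a DAG circuit whose leaves are literals or constants and whose internal nodes are binary $\land$/$\lor$-gates, such that the inputs of every $\land$-gate share no variable; its size is its number of gates. -}

module Defs where

open import Data.Nat using (ℕ; zero; suc; _≤_)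
open import Data.Fin using (Fin; zero; suc; punchIn; punchOut; _≟_)
open import Data.Bool using (Bool; true; false; not; _∧_; _∨_; _xor_; if_then_else_)
open import Data.List using (List; map; foldr; allFin; filter; length)
open import Data.Product using (Σ; _×_; _,_; proj₁; proj₂; swap)
open import Data.Sum using (_⊎_)
open import Data.Empty using (⊥)
open import Data.Unit using (⊤)
open import Relation.Nullary using (¬_)
open import Relation.Nullary.Decidable using (⌊_⌋)
open import Relation.Binary.PropositionalEquality using (_≡_; _≢_; sym)
open import Function.Bundles using (_↔_; Inverse)

-- Graphs: finite (multi)graphs with vertex set Fin n and edge set Fin m;
-- each edge is given by its pair of endpoints.

Graph : ℕ → ℕ → Set
Graph n m = Fin m → Fin n × Fin n

Loopless : ∀ {n m} → Graph n m → Set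
Loopless G = ∀ e → proj₁ (G e) ≢ proj₂ (G e)

Inc : ∀ {n m} → Graph n m → Fin n → Fin m → Set
Inc G v e = (proj₁ (G e) ≡ v) ⊎ (proj₂ (G e) ≡ v)

incB : ∀ {n m} → Graph n m → Fin n → Fin m → Bool
incB G v e = ⌊ proj₁ (G e) ≟ v ⌋ ∨ ⌊ proj₂ (G e) ≟ v ⌋

-- degree of v (number of incident edges; for loopless graphs this is the usual degree)
deg : ∀ {n m} → Graph n m → Fin n → ℕ
deg {m = m} G v = length (filter (λ e → incB G v e ≟B true) (allFin m))
  where
  open import Data.Bool.Properties renaming (_≟_ to _≟B_)

Isolated : ∀ {n m} → Graph n m → Fin n → Set
Isolated G v = ∀ e → ¬ Inc G v e

other : ∀ {n} → Fin n × Fin n → Fin n → Fin n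
other (x , y) v = if ⌊ x ≟ v ⌋ then y else x

delEdge : ∀ {n m} → Graph n (suc m) → Fin (suc m) → Graph n m
delEdge G e i = G (punchIn e i)

delVertex : ∀ {n m} (G : Graph (suc n) m) (v : Fin (suc n)) → Isolated G v → Graph n m
delVertex G v iso e =
  punchOut {i = v} {j = proj₁ (G e)} (λ eq → iso e (Data.Sum.inj₁ (sym eq))) ,
  punchOut {i = v} {j = proj₂ (G e)} (λ eq → iso e (Data.Sum.inj₂ (sym eq)))

addEdge : ∀ {n m} → Fin n × Fin n → Graph n m → Graph n (suc m)
addEdge p G zero = p
addEdge p G (suc i) = G i

-- for a vertex v whose incident edges are e₁ ≠ e₂: delete e₁ and e₂ and
-- join the two neighbours of v by a new edge (v is then isolated and is
-- deleted afterwards, see _≼_)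
suppressEdges : ∀ {n m} (G : Graph n (suc (suc m))) (v : Fin n)
  (e₁ e₂ : Fin (suc (suc m))) → e₁ ≢ e₂ → Graph n (suc m)
suppressEdges G v e₁ e₂ ne =
  addEdge (other (G e₁) v , other (G e₂) v)
          (delEdge (delEdge G e₁) (punchOut ne))

-- isomorphism of graphs (vertex and edge bijections; edges are unordered)
Iso : ∀ {n m n' m'} → Graph n m → Graph n' m' → Set
Iso {n} {m} {n'} {m'} G H =
  Σ (Fin n ↔ Fin n') λ σ → Σ (Fin m ↔ Fin m') λ τ →
    ∀ e → let (x , y) = G e
              f = Inverse.to σ
          in (H (Inverse.to τ e) ≡ (f x , f y)) ⊎ (H (Inverse.to τ e) ≡ (f y , f x))

data _≼_ {n' m'} (H : Graph n' m') : ∀ {n m} → Graph n m → Set where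
  ≼-iso : ∀ {n m} {G : Graph n m} → Iso G H → H ≼ G
  ≼-delEdge : ∀ {n m} {G : Graph n (suc m)} (e : Fin (suc m)) →
    H ≼ delEdge G e → H ≼ G
  ≼-delVertex : ∀ {n m} {G : Graph (suc n) m} (v : Fin (suc n)) (iso : Isolated G v) →
    H ≼ delVertex G v iso → H ≼ G
  ≼-suppress : ∀ {n m} {G : Graph (suc n) (suc (suc m))} (v : Fin (suc n))
    (e₁ e₂ : Fin (suc (suc m))) (ne : e₁ ≢ e₂) →
    deg G v ≡ 2 → Inc G v e₁ → Inc G v e₂ →
    other (G e₁) v ≢ other (G e₂) v →
    (iso : Isolated (suppressEdges G v e₁ e₂ ne) v) →
    H ≼ delVertex (suppressEdges G v e₁ e₂ ne) v iso → H ≼ G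

parityAt : ∀ {n m} → Graph n m → (Fin m → Bool) → Fin n → Bool
parityAt {m = m} G x v = foldr _xor_ false (map (λ e → incB G v e ∧ x e) (allFin m))

Tseitin0 : ∀ {n m} → Graph n m → (Fin m → Bool) → Bool
Tseitin0 {n} G x = foldr _∧_ true (map (λ v → not (parityAt G x v)) (allFin n))

-- Circuits over variables Fin k, as a DAG: a sequence of binary gates,
-- each gate taking its inputs among leaves (literals, constants) and
-- earlier gates.  In  Input k g , "gate zero" is the most recently added
-- of the g existing gates, "gate (suc j)" refers to earlier ones.

data Op : Set where
  and or : Op

data Input (k g : ℕ) : Set where
  lit   : Fin k → Bool → Input k g
  const : Bool → Input k g
  gate  : Fin g → Input k g

Gate : ℕ → ℕ → Set
Gate k g = Op × Input k g × Input k g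

data Circ (k : ℕ) : ℕ → Set where
  []  : Circ k 0
  _▷_ : ∀ {g} → Circ k g → Gate k g → Circ k (suc g)

applyOp : Op → Bool → Bool → Bool
applyOp and a b = a ∧ b
applyOp or  a b = a ∨ b

evalIn : ∀ {k g} → Circ k g → (Fin k → Bool) → Input k g → Bool
evalIn C ρ (lit x b) = if b then ρ x else not (ρ x)
evalIn C ρ (const b) = b
evalIn (C ▷ (o , a , b)) ρ (gate zero) = applyOp o (evalIn C ρ a) (evalIn C ρ b)
evalIn (C ▷ _) ρ (gate (suc j)) = evalIn C ρ (gate j)

Occ : ∀ {k g} → Circ k g → Fin k → Input k g → Set
Occ C y (lit x b) = x ≡ y
Occ C y (const b) = ⊥
Occ (C ▷ (o , a , b)) y (gate zero) = Occ C y a ⊎ Occ C y b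
Occ (C ▷ _) y (gate (suc j)) = Occ C y (gate j)

Decomposable : ∀ {k g} → Circ k g → Set
Decomposable [] = ⊤
Decomposable (C ▷ (and , a , b)) = Decomposable C × (∀ y → Occ C y a → Occ C y b → ⊥)
Decomposable (C ▷ (or , a , b)) = Decomposable C

record DNNF (k s : ℕ) : Set where
  field
    circ   : Circ k s
    output : Input k s
    decomposable : Decomposable circ

Computes : ∀ {k s} → DNNF k s → ((Fin k → Bool) → Bool) → Set
Computes D f = ∀ ρ → evalIn (DNNF.circ D) ρ (DNNF.output D) ≡ f ρ

{-# OPTIONS --safe #-}
module Submission where

-- Each operation producing a topological minor is simulated on a DNNF without adding gates.
-- Deleting an isolated vertex does not change T(G,0); deleting edge e substitutes x_e = 0, and an
-- isomorphism renames variables; both only replace literals by literals or constants, which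
-- preserves decomposability. Suppressing v with incident edges e₁, e₂ satisfies
-- T(G',0)(y) = ∃c. T(G,0)(x_{e₁} = y_new, x_{e₂} = c, rest of y), because the constraint at v
-- forces x_{e₁} = x_{e₂}. Existential quantification of one variable is realised in a DNNF by
-- replacing its literals by true: this is exact since at every ∧-gate at most one input contains
-- the variable.

open import Defs
open import Algebra.Bundles using (CommutativeMonoid; CommutativeRing)
import Algebra.Properties.CommutativeMonoid.Sum as Sum
open import Data.Bool using (Bool; true; false; not; _∧_; _∨_; _xor_; if_then_else_)
open import Data.Bool.Properties
  using (∧-commutativeMonoid; ∨-commutativeMonoid; xor-∧-commutativeRing; ∨-idem; ∨-comm; ∨-identityʳ;
         ∧-zeroʳ; ∧-distribˡ-∨; ∧-distribʳ-∨; xor-identityʳ; xor-same; xor-inverseʳ)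
  renaming (_≟_ to _≟B_)
open import Algebra.Properties.CommutativeSemigroup (CommutativeMonoid.commutativeSemigroup ∨-commutativeMonoid)
  using () renaming (interchange to ∨-interchange)
open import Data.Empty using (⊥; ⊥-elim)
open import Data.Fin using (Fin; zero; suc; punchIn; punchOut; _≟_)
open import Data.Fin.Properties using (punchIn-punchOut; punchIn-injective; punchInᵢ≢i; punchOut-injective; suc-injective)
open import Data.List as List using ([]; _∷_; allFin; filter; length)
open import Data.List.Properties using (map-tabulate; map-cong)
open import Data.Nat using (ℕ; zero; suc; _+_; _∸_; _≤_)
open import Data.Nat.ListAction using (sum)
open import Data.Nat.Properties using (+-0-commutativeMonoid; m+n≡0⇒m≡0; m+n≡0⇒n≡0; ≤-refl)
open import Data.Product using (Σ; ∃; ∃₂; _×_; _,_; proj₁; proj₂)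
open import Data.Sum using (_⊎_; inj₁; inj₂; [_,_]′)
open import Data.Sum.Properties using (inj₁-injective)
open import Data.Unit using (tt)
import Data.Vec.Functional as Vector
open import Data.Vec.Functional using (Vector; map; insertAt; updateAt)
open import Data.Vec.Functional.Properties using (insertAt-lookup; insertAt-punchIn; updateAt-updates; updateAt-minimal)
open import Function using (_∘_; id)
open import Function.Bundles using (Inverse; Injection; _↔_)
open import Function.Properties.Inverse using (↔⇒↣)
open import Relation.Binary.PropositionalEquality
open import Relation.Nullary using (¬_; Dec; yes; no)
open import Relation.Nullary.Decidable using (⌊_⌋)
open ≡-Reasoning

open Sum (CommutativeRing.+-commutativeMonoid xor-∧-commutativeRing)
  using () renaming (sum to ⨁; sum-remove to ⨁-remove; sum-cong-≗ to ⨁-cong; sum-permute to ⨁-permute;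
                     sum-replicate-zero to ⨁-zero)
open Sum ∧-commutativeMonoid
  using () renaming (sum to ⋀; sum-remove to ⋀-remove; sum-cong-≗ to ⋀-cong; sum-permute to ⋀-permute)
open Sum +-0-commutativeMonoid
  using () renaming (sum to ∑; sum-remove to ∑-remove)

foldr-map-allFin : ∀ {A B : Set} (_∙_ : A → B → B) (ε : B) {m} (f : Fin m → A) →
  List.foldr _∙_ ε (List.map f (allFin m)) ≡ Vector.foldr _∙_ ε f
foldr-map-allFin {A} _∙_ ε f = trans (cong (List.foldr _∙_ ε) (map-tabulate id f)) (foldr-tabulate f)
  where
  foldr-tabulate : ∀ {m} (f : Fin m → A) → List.foldr _∙_ ε (List.tabulate f) ≡ Vector.foldr _∙_ ε f
  foldr-tabulate {zero} f = refl
  foldr-tabulate {suc m} f = cong (f zero ∙_) (foldr-tabulate (f ∘ suc))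

parity : ∀ {n m} → Graph n m → (Fin m → Bool) → Fin n → Bool
parity G x v = ⨁ λ e → incB G v e ∧ x e

Tseitin0-⋀ : ∀ {n m} (G : Graph n m) x → Tseitin0 G x ≡ ⋀ (not ∘ parity G x)
Tseitin0-⋀ {n} G x = trans
  (cong (List.foldr _∧_ true) (map-cong (λ v → cong not (foldr-map-allFin _xor_ false (λ e → incB G v e ∧ x e))) (allFin n)))
  (foldr-map-allFin _∧_ true (not ∘ parity G x))

-- Substitution of literals in DNNFs

DNNFOf : ∀ {k} → ℕ → ((Fin k → Bool) → Bool) → Set
DNNFOf {k} s f = Σ (DNNF k s) λ D → Computes D f

DNNFOf-cong : ∀ {k s} {f g : (Fin k → Bool) → Bool} → (∀ ρ → f ρ ≡ g ρ) → DNNFOf s f → DNNFOf s g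
DNNFOf-cong f≗g (D , D-f) = D , λ ρ → trans (D-f ρ) (f≗g ρ)

evalLit : Bool → Bool → Bool
evalLit v b = if b then v else not v

data Leaf (k : ℕ) : Set where
  lit   : Fin k → Bool → Leaf k
  const : Bool → Leaf k

leafInput : ∀ {k g} → Leaf k → Input k g
leafInput (lit x b) = lit x b
leafInput (const b) = const b

evalLeaf : ∀ {k} → (Fin k → Bool) → Leaf k → Bool
evalLeaf ρ (lit x b) = evalLit (ρ x) b
evalLeaf ρ (const b) = b

OccLeaf : ∀ {k} → Fin k → Leaf k → Set
OccLeaf y (lit x b) = x ≡ y
OccLeaf y (const b) = ⊥

evalIn-leafInput : ∀ {k g} (C : Circ k g) ρ l → evalIn C ρ (leafInput l) ≡ evalLeaf ρ l
evalIn-leafInput C ρ (lit x b) = refl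
evalIn-leafInput C ρ (const b) = refl

Occ-leafInput : ∀ {k g} (C : Circ k g) {y} l → Occ C y (leafInput l) → OccLeaf y l
Occ-leafInput C (lit x b) occ = occ

occ? : ∀ {k g} (C : Circ k g) y a → Dec (Occ C y a)
occ? C y (lit x b) = x ≟ y
occ? C y (const b) = no λ ()
occ? (C ▷ (o , a , b)) y (gate zero) with occ? C y a | occ? C y b
... | yes p | _     = yes (inj₁ p)
... | no _  | yes q = yes (inj₂ q)
... | no p  | no q  = no λ { (inj₁ r) → p r ; (inj₂ r) → q r }
occ? (C ▷ _) y (gate (suc j)) = occ? C y (gate j)

decomposable-init : ∀ {k g} {C : Circ k g} {t : Gate k g} → Decomposable (C ▷ t) → Decomposable C
decomposable-init {t = and , _} = proj₁
decomposable-init {t = or , _}  = id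

module Substitution {k k'} (θ : Fin k → Bool → Leaf k') where

  substIn : ∀ {g} → Input k g → Input k' g
  substIn (lit x b) = leafInput (θ x b)
  substIn (const b) = const b
  substIn (gate j)  = gate j

  substCirc : ∀ {g} → Circ k g → Circ k' g
  substCirc [] = []
  substCirc (C ▷ (o , a , b)) = substCirc C ▷ (o , substIn a , substIn b)

  evalIn-subst : ∀ {g} (C : Circ k g) a ρ ρ' →
    (∀ x → Occ C x a → ∀ b → evalLeaf ρ' (θ x b) ≡ evalLit (ρ x) b) →
    evalIn (substCirc C) ρ' (substIn a) ≡ evalIn C ρ a
  evalIn-subst C (lit x b) ρ ρ' agree = trans (evalIn-leafInput (substCirc C) ρ' (θ x b)) (agree x refl b)
  evalIn-subst C (const b) ρ ρ' agree = refl
  evalIn-subst (C ▷ (o , a , b)) (gate zero) ρ ρ' agree =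
    cong₂ (applyOp o) (evalIn-subst C a ρ ρ' (λ x → agree x ∘ inj₁)) (evalIn-subst C b ρ ρ' (λ x → agree x ∘ inj₂))
  evalIn-subst (C ▷ _) (gate (suc j)) ρ ρ' agree = evalIn-subst C (gate j) ρ ρ' agree

  Occ-subst : ∀ {g} (C : Circ k g) a {y} → Occ (substCirc C) y (substIn a) →
    ∃₂ λ x b → Occ C x a × OccLeaf y (θ x b)
  Occ-subst C (lit x b) occ = x , b , refl , Occ-leafInput (substCirc C) (θ x b) occ
  Occ-subst (C ▷ (o , a , b)) (gate zero) (inj₁ occ) with Occ-subst C a occ
  ... | x , c , occ-x , occ-θ = x , c , inj₁ occ-x , occ-θ
  Occ-subst (C ▷ (o , a , b)) (gate zero) (inj₂ occ) with Occ-subst C b occ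
  ... | x , c , occ-x , occ-θ = x , c , inj₂ occ-x , occ-θ
  Occ-subst (C ▷ _) (gate (suc j)) occ = Occ-subst C (gate j) occ

  Separating : Set
  Separating = ∀ {x x' b b' y} → OccLeaf y (θ x b) → OccLeaf y (θ x' b') → x ≡ x'

  decomposable-subst : Separating → ∀ {g} (C : Circ k g) → Decomposable C → Decomposable (substCirc C)
  decomposable-subst sep [] _ = tt
  decomposable-subst sep (C ▷ (and , a , b)) (dec , disjoint) = decomposable-subst sep C dec , λ y occ-a occ-b →
    let (x  , _ , occ-x  , θ-x)  = Occ-subst C a occ-a
        (x' , _ , occ-x' , θ-x') = Occ-subst C b occ-b
    in disjoint x occ-x (subst (λ z → Occ C z b) (sym (sep θ-x θ-x')) occ-x')
  decomposable-subst sep (C ▷ (or , a , b)) dec = decomposable-subst sep C dec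

  substDNNF : Separating → ∀ {s} → DNNF k s → DNNF k' s
  substDNNF sep D = record
    { circ = substCirc (DNNF.circ D)
    ; output = substIn (DNNF.output D)
    ; decomposable = decomposable-subst sep (DNNF.circ D) (DNNF.decomposable D)
    }

-- σ x = inj₁ y renames the variable x to y, σ x = inj₂ c fixes it to the constant c.
pullback : ∀ {k k'} → (Fin k → Fin k' ⊎ Bool) → (Fin k' → Bool) → Fin k → Bool
pullback σ ρ = [ ρ , id ]′ ∘ σ

VarInjective : ∀ {k k'} → (Fin k → Fin k' ⊎ Bool) → Set
VarInjective σ = ∀ {x x' y} → σ x ≡ inj₁ y → σ x' ≡ inj₁ y → x ≡ x'

module _ {k k'} (σ : Fin k → Fin k' ⊎ Bool) where

  restrictLeaf : Fin k → Bool → Leaf k'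
  restrictLeaf x b = [ (λ y → lit y b) , (λ c → const (evalLit c b)) ]′ (σ x)

  evalLeaf-restrict : ∀ ρ x b → evalLeaf ρ (restrictLeaf x b) ≡ evalLit (pullback σ ρ x) b
  evalLeaf-restrict ρ x b with σ x
  ... | inj₁ _ = refl
  ... | inj₂ _ = refl

  OccLeaf-restrict : ∀ {x b y} → OccLeaf y (restrictLeaf x b) → σ x ≡ inj₁ y
  OccLeaf-restrict {x} occ with σ x
  OccLeaf-restrict refl | inj₁ _ = refl

  open Substitution restrictLeaf

  restrict : VarInjective σ → ∀ {s f} → DNNFOf s f → DNNFOf s (f ∘ pullback σ)
  restrict σ-inj (D , D-f) = substDNNF separating D , λ ρ →
    trans (evalIn-subst (DNNF.circ D) (DNNF.output D) (pullback σ ρ) ρ (λ x _ → evalLeaf-restrict ρ x))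
          (D-f (pullback σ ρ))
    where
    separating : Separating
    separating occ occ' = σ-inj (OccLeaf-restrict occ) (OccLeaf-restrict occ')

evalLit-false∨true : ∀ b → evalLit false b ∨ evalLit true b ≡ true
evalLit-false∨true false = refl
evalLit-false∨true true  = refl

_[_≔_] : ∀ {k} → (Fin k → Bool) → Fin k → Bool → Fin k → Bool
ρ [ z ≔ c ] = updateAt ρ z λ _ → c

module _ {k} (z : Fin k) where

  forgetLeaf : Fin k → Bool → Leaf k
  forgetLeaf x b with x ≟ z
  ... | yes _ = const true
  ... | no _  = lit x b

  open Substitution forgetLeaf

  separating : Separating
  separating {x} {x'} occ occ' with x ≟ z | x' ≟ z
  separating refl refl | no _ | no _ = refl

  evalForgotten : ∀ {g} → Circ k g → (Fin k → Bool) → Input k g → Bool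
  evalForgotten C ρ a = evalIn (substCirc C) ρ (substIn a)

  evalWith : ∀ {g} → Circ k g → (Fin k → Bool) → Bool → Input k g → Bool
  evalWith C ρ c = evalIn C (ρ [ z ≔ c ])

  evalForgotten-∉ : ∀ {g} (C : Circ k g) a ρ c → ¬ Occ C z a → evalForgotten C ρ a ≡ evalWith C ρ c a
  evalForgotten-∉ C a ρ c z∉a = evalIn-subst C a (ρ [ z ≔ c ]) ρ agree
    where
    agree : ∀ x → Occ C x a → ∀ b → evalLeaf ρ (forgetLeaf x b) ≡ evalLit ((ρ [ z ≔ c ]) x) b
    agree x x∈a b with x ≟ z
    ... | yes refl = ⊥-elim (z∉a x∈a)
    ... | no x≢z = cong (λ v → evalLit v b) (sym (updateAt-minimal x z ρ x≢z))

  -- By decomposability one input of an ∧-gate does not mention z, so ∃z commutes with ∧.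
  evalForgotten-∃ : ∀ {g} (C : Circ k g) → Decomposable C → ∀ a ρ →
    evalForgotten C ρ a ≡ evalWith C ρ false a ∨ evalWith C ρ true a
  evalForgotten-∃ C dec (lit x b) ρ with x ≟ z
  ... | yes refl = sym (trans
    (cong₂ (λ v w → evalLit v b ∨ evalLit w b) (updateAt-updates z ρ) (updateAt-updates z ρ))
    (evalLit-false∨true b))
  ... | no x≢z = sym (trans
    (cong₂ (λ v w → evalLit v b ∨ evalLit w b) (updateAt-minimal x z ρ x≢z) (updateAt-minimal x z ρ x≢z))
    (∨-idem (evalLit (ρ x) b)))
  evalForgotten-∃ C dec (const b) ρ = sym (∨-idem b)
  evalForgotten-∃ (C ▷ (or , a , b)) dec (gate zero) ρ =
    trans (cong₂ _∨_ (evalForgotten-∃ C dec a ρ) (evalForgotten-∃ C dec b ρ))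
          (∨-interchange (evalWith C ρ false a) (evalWith C ρ true a) (evalWith C ρ false b) (evalWith C ρ true b))
  evalForgotten-∃ {suc g} (C ▷ (and , a , b)) (dec , disjoint) (gate zero) ρ with occ? C z a
  ... | no z∉a = begin
    F a ∧ F b                                       ≡⟨ cong (F a ∧_) (evalForgotten-∃ C dec b ρ) ⟩
    F a ∧ (E false b ∨ E true b)                    ≡⟨ ∧-distribˡ-∨ (F a) (E false b) (E true b) ⟩
    (F a ∧ E false b) ∨ (F a ∧ E true b)
      ≡⟨ cong₂ (λ u w → (u ∧ E false b) ∨ (w ∧ E true b))
               (evalForgotten-∉ C a ρ false z∉a) (evalForgotten-∉ C a ρ true z∉a) ⟩
    (E false a ∧ E false b) ∨ (E true a ∧ E true b) ∎
    where
    F : Input k g → Bool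
    F = evalForgotten C ρ
    E : Bool → Input k g → Bool
    E = evalWith C ρ
  ... | yes z∈a = begin
    F a ∧ F b                                       ≡⟨ cong (_∧ F b) (evalForgotten-∃ C dec a ρ) ⟩
    (E false a ∨ E true a) ∧ F b                    ≡⟨ ∧-distribʳ-∨ (F b) (E false a) (E true a) ⟩
    (E false a ∧ F b) ∨ (E true a ∧ F b)
      ≡⟨ cong₂ (λ u w → (E false a ∧ u) ∨ (E true a ∧ w))
               (evalForgotten-∉ C b ρ false z∉b) (evalForgotten-∉ C b ρ true z∉b) ⟩
    (E false a ∧ E false b) ∨ (E true a ∧ E true b) ∎
    where
    F : Input k g → Bool
    F = evalForgotten C ρ
    E : Bool → Input k g → Bool
    E = evalWith C ρ
    z∉b : ¬ Occ C z b
    z∉b = disjoint z z∈a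
  evalForgotten-∃ (C ▷ t) dec (gate (suc j)) ρ = evalForgotten-∃ C (decomposable-init {t = t} dec) (gate j) ρ

  forget : ∀ {s f} → DNNFOf s f → DNNFOf s (λ ρ → f (ρ [ z ≔ false ]) ∨ f (ρ [ z ≔ true ]))
  forget (D , D-f) = substDNNF separating D , λ ρ →
    trans (evalForgotten-∃ (DNNF.circ D) (DNNF.decomposable D) (DNNF.output D) ρ)
          (cong₂ _∨_ (D-f _) (D-f _))

punchIn-or-self : ∀ {m} (e x : Fin (suc m)) → e ≡ x ⊎ ∃ λ i → punchIn e i ≡ x
punchIn-or-self e x with e ≟ x
... | yes e≡x = inj₁ e≡x
... | no e≢x  = inj₂ (punchOut e≢x , punchIn-punchOut e≢x)

map-insertAt : ∀ {A B : Set} {m} (f : A → B) (xs : Vector A m) e a →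
  ∀ x → map f (insertAt xs e a) x ≡ insertAt (map f xs) e (f a) x
map-insertAt f xs e a x with punchIn-or-self e x
... | inj₁ refl = trans (cong f (insertAt-lookup xs e a)) (sym (insertAt-lookup (map f xs) e (f a)))
... | inj₂ (i , refl) = trans (cong f (insertAt-punchIn xs e a i)) (sym (insertAt-punchIn (map f xs) e (f a) i))

insertAt-varInjective : ∀ {k k'} {σ : Fin k → Fin k' ⊎ Bool} → VarInjective σ → ∀ e a →
  (∀ {y} → a ≡ inj₁ y → ∀ x → σ x ≢ inj₁ y) → VarInjective (insertAt σ e a)
insertAt-varInjective {σ = σ} σ-inj e a fresh {x} {x'} p p'
  with punchIn-or-self e x | punchIn-or-self e x'
... | inj₁ refl | inj₁ refl = refl
... | inj₁ refl | inj₂ (i' , refl) =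
  ⊥-elim (fresh (trans (sym (insertAt-lookup σ e a)) p) i' (trans (sym (insertAt-punchIn σ e a i')) p'))
... | inj₂ (i , refl) | inj₁ refl =
  ⊥-elim (fresh (trans (sym (insertAt-lookup σ e a)) p') i (trans (sym (insertAt-punchIn σ e a i)) p))
... | inj₂ (i , refl) | inj₂ (i' , refl) =
  cong (punchIn e) (σ-inj (trans (sym (insertAt-punchIn σ e a i)) p) (trans (sym (insertAt-punchIn σ e a i')) p'))

inj₁-varInjective : ∀ {k k'} {f : Fin k → Fin k'} → (∀ {x y} → f x ≡ f y → x ≡ y) → VarInjective (inj₁ ∘ f)
inj₁-varInjective f-inj p p' = f-inj (inj₁-injective (trans p (sym p')))

-- Tseitin formulas under graph operations

⌊≟⌋-injective : ∀ {a b} {f : Fin a → Fin b} → (∀ {x y} → f x ≡ f y → x ≡ y) →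
  ∀ x y → ⌊ f x ≟ f y ⌋ ≡ ⌊ x ≟ y ⌋
⌊≟⌋-injective {f = f} f-inj x y with f x ≟ f y | x ≟ y
... | yes _ | yes _ = refl
... | no _  | no _  = refl
... | yes fx≡fy | no x≢y = ⊥-elim (x≢y (f-inj fx≡fy))
... | no fx≢fy | yes refl = ⊥-elim (fx≢fy refl)

Tseitin0-cong-parity : ∀ {n m m'} (G : Graph n m) x (H : Graph n m') y →
  (∀ v → parity G x v ≡ parity H y v) → Tseitin0 G x ≡ Tseitin0 H y
Tseitin0-cong-parity G x H y same = begin
  Tseitin0 G x         ≡⟨ Tseitin0-⋀ G x ⟩
  ⋀ (not ∘ parity G x) ≡⟨ ⋀-cong (cong not ∘ same) ⟩
  ⋀ (not ∘ parity H y) ≡⟨ Tseitin0-⋀ H y ⟨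
  Tseitin0 H y         ∎

Tseitin0-cong : ∀ {n m} (G : Graph n m) {x y} → (∀ e → x e ≡ y e) → Tseitin0 G x ≡ Tseitin0 G y
Tseitin0-cong G {x} {y} x≗y = Tseitin0-cong-parity G x G y λ v → ⨁-cong λ e → cong (incB G v e ∧_) (x≗y e)

Tseitin0-odd : ∀ {n m} (G : Graph (suc n) m) x v → parity G x v ≡ true → Tseitin0 G x ≡ false
Tseitin0-odd G x v odd = begin
  Tseitin0 G x                                          ≡⟨ Tseitin0-⋀ G x ⟩
  ⋀ (not ∘ parity G x)                                  ≡⟨ ⋀-remove {i = v} (not ∘ parity G x) ⟩
  not (parity G x v) ∧ ⋀ (not ∘ parity G x ∘ punchIn v)
    ≡⟨ cong (λ b → not b ∧ ⋀ (not ∘ parity G x ∘ punchIn v)) odd ⟩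
  false                                                 ∎

Tseitin0-delEdge : ∀ {n m} (G : Graph n (suc m)) e ρ → Tseitin0 (delEdge G e) ρ ≡ Tseitin0 G (insertAt ρ e false)
Tseitin0-delEdge {m = m} G e ρ = Tseitin0-cong-parity (delEdge G e) ρ G x λ v → sym (begin
  parity G x v                                                    ≡⟨ ⨁-remove {i = e} (λ d → incB G v d ∧ x d) ⟩
  (incB G v e ∧ x e) xor ⨁ (λ i → incB G v (punchIn e i) ∧ x (punchIn e i))
    ≡⟨ cong₂ _xor_ (trans (cong (incB G v e ∧_) (insertAt-lookup ρ e false)) (∧-zeroʳ _))
                   (⨁-cong λ i → cong (incB G v (punchIn e i) ∧_) (insertAt-punchIn ρ e false i)) ⟩
  parity (delEdge G e) ρ v                                        ∎)
  where
  x : Fin (suc m) → Bool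
  x = insertAt ρ e false

⌊≟punchIn⌋ : ∀ {n} {i j : Fin (suc n)} (i≢j : i ≢ j) w → ⌊ j ≟ punchIn i w ⌋ ≡ ⌊ punchOut i≢j ≟ w ⌋
⌊≟punchIn⌋ {i = i} i≢j w = trans
  (cong (λ j → ⌊ j ≟ punchIn i w ⌋) (sym (punchIn-punchOut i≢j)))
  (⌊≟⌋-injective (punchIn-injective i _ _) (punchOut i≢j) w)

module _ {n m} (G : Graph (suc n) m) (v : Fin (suc n)) (iso : Isolated G v) where

  incB-isolated : ∀ e → incB G v e ≡ false
  incB-isolated e with proj₁ (G e) ≟ v | proj₂ (G e) ≟ v
  ... | yes x≡v | _       = ⊥-elim (iso e (inj₁ x≡v))
  ... | no _    | yes y≡v = ⊥-elim (iso e (inj₂ y≡v))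
  ... | no _    | no _    = refl

  incB-delVertex : ∀ w e → incB G (punchIn v w) e ≡ incB (delVertex G v iso) w e
  incB-delVertex w e = cong₂ _∨_
    (⌊≟punchIn⌋ (λ v≡x → iso e (inj₁ (sym v≡x))) w)
    (⌊≟punchIn⌋ (λ v≡y → iso e (inj₂ (sym v≡y))) w)

  Tseitin0-delVertex : ∀ ρ → Tseitin0 G ρ ≡ Tseitin0 (delVertex G v iso) ρ
  Tseitin0-delVertex ρ = begin
    Tseitin0 G ρ                                            ≡⟨ Tseitin0-⋀ G ρ ⟩
    ⋀ (not ∘ parity G ρ)                                    ≡⟨ ⋀-remove {i = v} (not ∘ parity G ρ) ⟩
    not (parity G ρ v) ∧ ⋀ (not ∘ parity G ρ ∘ punchIn v)
      ≡⟨ cong₂ (λ b c → not b ∧ c) parity-v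
               (⋀-cong λ w → cong not (⨁-cong λ e → cong (_∧ ρ e) (incB-delVertex w e))) ⟩
    ⋀ (not ∘ parity (delVertex G v iso) ρ)                  ≡⟨ Tseitin0-⋀ (delVertex G v iso) ρ ⟨
    Tseitin0 (delVertex G v iso) ρ                          ∎
    where
    parity-v : parity G ρ v ≡ false
    parity-v = trans (⨁-cong λ e → cong (_∧ ρ e) (incB-isolated e)) (⨁-zero m)

  loopless-delVertex : Loopless G → Loopless (delVertex G v iso)
  loopless-delVertex ll e = ll e ∘ punchOut-injective (λ v≡x → iso e (inj₁ (sym v≡x))) (λ v≡y → iso e (inj₂ (sym v≡y)))

module _ {n m n' m'} (G : Graph n m) (H : Graph n' m') (I : Iso G H) where

  private
    σ : Fin n ↔ Fin n'
    σ = proj₁ I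
    τ : Fin m ↔ Fin m'
    τ = proj₁ (proj₂ I)
    f : Fin n → Fin n'
    f = Inverse.to σ
    t : Fin m → Fin m'
    t = Inverse.to τ
    ⌊f≟f⌋ : ∀ u v → ⌊ f u ≟ f v ⌋ ≡ ⌊ u ≟ v ⌋
    ⌊f≟f⌋ = ⌊≟⌋-injective (Injection.injective (↔⇒↣ σ))

  incB-iso : ∀ v e → incB H (f v) (t e) ≡ incB G v e
  incB-iso v e with H (t e) | proj₂ (proj₂ I) e
  ... | ._ | inj₁ refl = cong₂ _∨_ (⌊f≟f⌋ x v) (⌊f≟f⌋ y v)
    where open Σ (G e) renaming (proj₁ to x; proj₂ to y)
  ... | ._ | inj₂ refl = trans (∨-comm ⌊ f y ≟ f v ⌋ ⌊ f x ≟ f v ⌋) (cong₂ _∨_ (⌊f≟f⌋ x v) (⌊f≟f⌋ y v))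
    where open Σ (G e) renaming (proj₁ to x; proj₂ to y)

  Tseitin0-iso : ∀ ρ → Tseitin0 H ρ ≡ Tseitin0 G (ρ ∘ t)
  Tseitin0-iso ρ = begin
    Tseitin0 H ρ                                       ≡⟨ Tseitin0-⋀ H ρ ⟩
    ⋀ (not ∘ parity H ρ)                               ≡⟨ ⋀-permute (not ∘ parity H ρ) σ ⟩
    ⋀ (λ v → not (parity H ρ (f v)))
      ≡⟨ ⋀-cong (λ v → cong not (⨁-permute (λ e → incB H (f v) e ∧ ρ e) τ)) ⟩
    ⋀ (λ v → not (⨁ λ e → incB H (f v) (t e) ∧ ρ (t e)))
      ≡⟨ ⋀-cong (λ v → cong not (⨁-cong λ e → cong (_∧ ρ (t e)) (incB-iso v e))) ⟩
    ⋀ (not ∘ parity G (ρ ∘ t))                         ≡⟨ Tseitin0-⋀ G (ρ ∘ t) ⟨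
    Tseitin0 G (ρ ∘ t)                                 ∎

-- Suppressing a vertex of degree two

length-filter-≟true : ∀ {A : Set} (b : A → Bool) xs →
  length (filter (λ x → b x ≟B true) xs) ≡ sum (List.map (λ x → if b x then 1 else 0) xs)
length-filter-≟true b [] = refl
length-filter-≟true b (x ∷ xs) with b x
... | true  = cong suc (length-filter-≟true b xs)
... | false = length-filter-≟true b xs

deg-∑ : ∀ {n m} (G : Graph n m) v → deg G v ≡ ∑ (λ e → if incB G v e then 1 else 0)
deg-∑ G v = trans (length-filter-≟true (incB G v) (allFin _)) (foldr-map-allFin _+_ 0 (λ e → if incB G v e then 1 else 0))

∑≡0⇒≡0 : ∀ {m} (f : Fin m → ℕ) → ∑ f ≡ 0 → ∀ i → f i ≡ 0
∑≡0⇒≡0 f ∑f≡0 zero    = m+n≡0⇒m≡0 (f zero) ∑f≡0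
∑≡0⇒≡0 f ∑f≡0 (suc i) = ∑≡0⇒≡0 (f ∘ suc) (m+n≡0⇒n≡0 (f zero) ∑f≡0) i

Inc⇒incB : ∀ {n m} (G : Graph n m) {v e} → Inc G v e → incB G v e ≡ true
Inc⇒incB G {v} {e} inc with proj₁ (G e) ≟ v | proj₂ (G e) ≟ v | inc
... | yes _ | _     | _      = refl
... | no _  | yes _ | _      = refl
... | no x≢v | no _ | inj₁ x≡v = ⊥-elim (x≢v x≡v)
... | no _  | no y≢v | inj₂ y≡v = ⊥-elim (y≢v y≡v)

other-≢ : ∀ {n} {x y v : Fin n} → x ≢ y → (x ≡ v) ⊎ (y ≡ v) → other (x , y) v ≢ v
other-≢ {x = x} {y} {v} x≢y v∈xy with x ≟ v | v∈xy
... | yes x≡v | _        = λ y≡v → x≢y (trans x≡v (sym y≡v))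
... | no x≢v  | _        = x≢v

incB-other : ∀ {n} {x y v w : Fin n} → (x ≡ v) ⊎ (y ≡ v) → v ≢ w →
  ⌊ x ≟ w ⌋ ∨ ⌊ y ≟ w ⌋ ≡ ⌊ other (x , y) v ≟ w ⌋
incB-other {x = x} {y} {v} {w} v∈xy v≢w with x ≟ v | v∈xy
... | yes refl | _ with x ≟ w
...   | yes refl = ⊥-elim (v≢w refl)
...   | no _     = refl
incB-other v∈xy v≢w | no x≢v | inj₁ x≡v = ⊥-elim (x≢v x≡v)
incB-other {y = y} {w = w} v∈xy v≢w | no _ | inj₂ refl with y ≟ w
...   | yes refl = ⊥-elim (v≢w refl)
...   | no _     = ∨-identityʳ _

⌊≟⌋-disjoint : ∀ {n} {p q : Fin n} → p ≢ q → ∀ w → ⌊ p ≟ w ⌋ ∧ ⌊ q ≟ w ⌋ ≡ false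
⌊≟⌋-disjoint {p = p} {q} p≢q w with p ≟ w | q ≟ w
... | yes refl | yes refl = ⊥-elim (p≢q refl)
... | yes _    | no _     = refl
... | no _     | _        = refl

xor-merge : ∀ a b → a ∧ b ≡ false → ∀ c r → (a ∧ c) xor ((b ∧ c) xor r) ≡ ((a ∨ b) ∧ c) xor r
xor-merge true  false _ c r = refl
xor-merge false b     _ c r = refl

∨-collapse : ∀ (g : Bool → Bool) b → g (not b) ≡ false → g false ∨ g true ≡ g b
∨-collapse g false g-true≡false  = trans (cong (g false ∨_) g-true≡false) (∨-identityʳ (g false))
∨-collapse g true  g-false≡false = cong (_∨ g true) g-false≡false

module Suppression {n m} (G : Graph (suc n) (suc (suc m))) (ll : Loopless G) (v : Fin (suc n))
  (e₁ e₂ : Fin (suc (suc m))) (e₁≢e₂ : e₁ ≢ e₂) (deg≡2 : deg G v ≡ 2)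
  (v∈e₁ : Inc G v e₁) (v∈e₂ : Inc G v e₂) (p≢q : other (G e₁) v ≢ other (G e₂) v) where

  S : Graph (suc n) (suc m)
  S = suppressEdges G v e₁ e₂ e₁≢e₂

  o₂ : Fin (suc m)
  o₂ = punchOut e₁≢e₂

  kept : Fin m → Fin (suc (suc m))
  kept k = punchIn e₁ (punchIn o₂ k)

  punchIn-o₂ : punchIn e₁ o₂ ≡ e₂
  punchIn-o₂ = punchIn-punchOut e₁≢e₂

  kept≢e₂ : ∀ k → kept k ≢ e₂
  kept≢e₂ k kept≡e₂ = punchInᵢ≢i o₂ k (punchIn-injective e₁ _ _ (trans kept≡e₂ (sym punchIn-o₂)))

  ⨁-split : ∀ f → ⨁ f ≡ f e₁ xor (f e₂ xor ⨁ (f ∘ kept))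
  ⨁-split f = trans (⨁-remove {i = e₁} f)
    (cong (f e₁ xor_) (trans (⨁-remove {i = o₂} (f ∘ punchIn e₁)) (cong (λ e → f e xor ⨁ (f ∘ kept)) punchIn-o₂)))

  ∑-split : ∀ f → ∑ f ≡ f e₁ + (f e₂ + ∑ (f ∘ kept))
  ∑-split f = trans (∑-remove {i = e₁} f)
    (cong (f e₁ +_) (trans (∑-remove {i = o₂} (f ∘ punchIn e₁)) (cong (λ e → f e + ∑ (f ∘ kept)) punchIn-o₂)))

  incB-v-kept : ∀ k → incB G v (kept k) ≡ false
  incB-v-kept k = count≡0 (incB G v (kept k)) (∑≡0⇒≡0 (count ∘ kept) rest≡0 k)
    where
    count : Fin (suc (suc m)) → ℕ
    count e = if incB G v e then 1 else 0
    count≡0 : ∀ b → (if b then 1 else 0) ≡ 0 → b ≡ false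
    count≡0 false _ = refl
    rest≡0 : ∑ (count ∘ kept) ≡ 0
    rest≡0 = cong (_∸ 2) (sym (begin
      2                                     ≡⟨ sym deg≡2 ⟩
      deg G v                               ≡⟨ deg-∑ G v ⟩
      ∑ count                               ≡⟨ ∑-split count ⟩
      count e₁ + (count e₂ + ∑ (count ∘ kept))
        ≡⟨ cong₂ (λ a b → (if a then 1 else 0) + ((if b then 1 else 0) + ∑ (count ∘ kept)))
                 (Inc⇒incB G v∈e₁) (Inc⇒incB G v∈e₂) ⟩
      2 + ∑ (count ∘ kept)                     ∎))

  shift : Fin m → Fin (suc m) ⊎ Bool
  shift = inj₁ ∘ suc

  relabel∖e₁ : Fin (suc m) → Fin (suc m) ⊎ Bool
  relabel∖e₁ = insertAt shift o₂ (inj₂ false)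

  -- e₁ becomes the new edge zero of S, e₂ is fixed (it will have been forgotten), kept k becomes suc k.
  relabel : Fin (suc (suc m)) → Fin (suc m) ⊎ Bool
  relabel = insertAt relabel∖e₁ e₁ (inj₁ zero)

  relabel-varInjective : VarInjective relabel
  relabel-varInjective =
    insertAt-varInjective (insertAt-varInjective (inj₁-varInjective suc-injective) o₂ (inj₂ false) λ ()) e₁ (inj₁ zero) fresh
    where
    fresh : ∀ {y} → inj₁ zero ≡ inj₁ y → ∀ x → relabel∖e₁ x ≢ inj₁ y
    fresh refl x with punchIn-or-self o₂ x
    ... | inj₁ refl rewrite insertAt-lookup shift o₂ (inj₂ false) = λ ()
    ... | inj₂ (i , refl) rewrite insertAt-punchIn shift o₂ (inj₂ false) i = λ ()

  lift : (Fin (suc m) → Bool) → Bool → Fin (suc (suc m)) → Bool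
  lift y c = pullback relabel y [ e₂ ≔ c ]

  lift-e₁ : ∀ y c → lift y c e₁ ≡ y zero
  lift-e₁ y c = trans (updateAt-minimal e₁ e₂ (pullback relabel y) e₁≢e₂)
                      (cong [ y , id ]′ (insertAt-lookup _ e₁ (inj₁ zero)))

  lift-e₂ : ∀ y c → lift y c e₂ ≡ c
  lift-e₂ y c = updateAt-updates e₂ (pullback relabel y)

  lift-kept : ∀ y c k → lift y c (kept k) ≡ y (suc k)
  lift-kept y c k = trans (updateAt-minimal (kept k) e₂ (pullback relabel y) (kept≢e₂ k))
    (cong [ y , id ]′ (trans (insertAt-punchIn _ e₁ (inj₁ zero) (punchIn o₂ k)) (insertAt-punchIn shift o₂ (inj₂ false) k)))

  p q : Fin (suc n)
  p = other (G e₁) v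
  q = other (G e₂) v

  rest : (Fin (suc m) → Bool) → Fin (suc n) → Bool
  rest y w = ⨁ λ k → incB G w (kept k) ∧ y (suc k)

  parity-lift : ∀ y c w → parity G (lift y c) w ≡ (incB G w e₁ ∧ y zero) xor ((incB G w e₂ ∧ c) xor rest y w)
  parity-lift y c w = begin
    parity G (lift y c) w
      ≡⟨ ⨁-split (λ e → incB G w e ∧ lift y c e) ⟩
    (incB G w e₁ ∧ lift y c e₁) xor ((incB G w e₂ ∧ lift y c e₂) xor ⨁ (λ k → incB G w (kept k) ∧ lift y c (kept k)))
      ≡⟨ cong₂ (λ a b → (incB G w e₁ ∧ a) xor ((incB G w e₂ ∧ b) xor ⨁ (λ k → incB G w (kept k) ∧ lift y c (kept k))))
               (lift-e₁ y c) (lift-e₂ y c) ⟩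
    (incB G w e₁ ∧ y zero) xor ((incB G w e₂ ∧ c) xor ⨁ (λ k → incB G w (kept k) ∧ lift y c (kept k)))
      ≡⟨ cong (λ r → (incB G w e₁ ∧ y zero) xor ((incB G w e₂ ∧ c) xor r))
              (⨁-cong λ k → cong (incB G w (kept k) ∧_) (lift-kept y c k)) ⟩
    (incB G w e₁ ∧ y zero) xor ((incB G w e₂ ∧ c) xor rest y w) ∎

  rest-v : ∀ y → rest y v ≡ false
  rest-v y = trans (⨁-cong λ k → cong (_∧ y (suc k)) (incB-v-kept k)) (⨁-zero m)

  parity-lift-v : ∀ y c → parity G (lift y c) v ≡ y zero xor c
  parity-lift-v y c = begin
    parity G (lift y c) v                                                ≡⟨ parity-lift y c v ⟩
    (incB G v e₁ ∧ y zero) xor ((incB G v e₂ ∧ c) xor rest y v)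
      ≡⟨ cong₂ (λ a b → (a ∧ y zero) xor ((b ∧ c) xor rest y v)) (Inc⇒incB G v∈e₁) (Inc⇒incB G v∈e₂) ⟩
    y zero xor (c xor rest y v)                                          ≡⟨ cong (λ r → y zero xor (c xor r)) (rest-v y) ⟩
    y zero xor (c xor false)                                             ≡⟨ cong (y zero xor_) (xor-identityʳ c) ⟩
    y zero xor c                                                         ∎

  parity-S-v : ∀ y → parity S y v ≡ false
  parity-S-v y = cong₂ (λ a r → (a ∧ y zero) xor r) pq∌v (rest-v y)
    where
    pq∌v : ⌊ p ≟ v ⌋ ∨ ⌊ q ≟ v ⌋ ≡ false
    pq∌v with p ≟ v | q ≟ v
    ... | yes p≡v | _       = ⊥-elim (other-≢ (ll e₁) v∈e₁ p≡v)
    ... | no _    | yes q≡v = ⊥-elim (other-≢ (ll e₂) v∈e₂ q≡v)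
    ... | no _    | no _    = refl

  parity-lift-S : ∀ y w → parity G (lift y (y zero)) w ≡ parity S y w
  parity-lift-S y w with v ≟ w
  ... | yes refl = trans (parity-lift-v y (y zero)) (trans (xor-same (y zero)) (sym (parity-S-v y)))
  ... | no v≢w = begin
    parity G (lift y (y zero)) w                                          ≡⟨ parity-lift y (y zero) w ⟩
    (incB G w e₁ ∧ y zero) xor ((incB G w e₂ ∧ y zero) xor rest y w)
      ≡⟨ cong₂ (λ a b → (a ∧ y zero) xor ((b ∧ y zero) xor rest y w)) (incB-other v∈e₁ v≢w) (incB-other v∈e₂ v≢w) ⟩
    (⌊ p ≟ w ⌋ ∧ y zero) xor ((⌊ q ≟ w ⌋ ∧ y zero) xor rest y w)
      ≡⟨ xor-merge ⌊ p ≟ w ⌋ ⌊ q ≟ w ⌋ (⌊≟⌋-disjoint p≢q w) (y zero) (rest y w) ⟩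
    parity S y w                                                          ∎

  Tseitin0-suppress : ∀ y → Tseitin0 G (lift y false) ∨ Tseitin0 G (lift y true) ≡ Tseitin0 S y
  Tseitin0-suppress y = begin
    Tseitin0 G (lift y false) ∨ Tseitin0 G (lift y true) ≡⟨ ∨-collapse (Tseitin0 G ∘ lift y) (y zero) odd ⟩
    Tseitin0 G (lift y (y zero))                         ≡⟨ Tseitin0-cong-parity G (lift y (y zero)) S y (parity-lift-S y) ⟩
    Tseitin0 S y                                         ∎
    where
    odd : Tseitin0 G (lift y (not (y zero))) ≡ false
    odd = Tseitin0-odd G _ v (trans (parity-lift-v y (not (y zero))) (xor-inverseʳ (y zero)))

  suppress-DNNF : ∀ {s} → DNNFOf s (Tseitin0 G) → DNNFOf s (Tseitin0 S)
  suppress-DNNF = DNNFOf-cong Tseitin0-suppress ∘ restrict relabel relabel-varInjective ∘ forget e₂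

  loopless-suppress : Loopless S
  loopless-suppress zero    = p≢q
  loopless-suppress (suc k) = ll (kept k)

delEdge-DNNF : ∀ {n m s} (G : Graph n (suc m)) e → DNNFOf s (Tseitin0 G) → DNNFOf s (Tseitin0 (delEdge G e))
delEdge-DNNF {m = m} G e = DNNFOf-cong Tseitin0-restricted ∘ restrict σ σ-varInjective
  where
  σ : Fin (suc m) → Fin m ⊎ Bool
  σ = insertAt inj₁ e (inj₂ false)
  σ-varInjective : VarInjective σ
  σ-varInjective = insertAt-varInjective (inj₁-varInjective id) e (inj₂ false) λ ()
  Tseitin0-restricted : ∀ ρ → Tseitin0 G (pullback σ ρ) ≡ Tseitin0 (delEdge G e) ρ
  Tseitin0-restricted ρ = trans (Tseitin0-cong G (map-insertAt [ ρ , id ]′ inj₁ e (inj₂ false)))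
                                (sym (Tseitin0-delEdge G e ρ))

iso-DNNF : ∀ {n m n' m' s} (G : Graph n m) (H : Graph n' m') → Iso G H → DNNFOf s (Tseitin0 G) → DNNFOf s (Tseitin0 H)
iso-DNNF G H I@(_ , τ , _) =
  DNNFOf-cong (sym ∘ Tseitin0-iso G H I)
  ∘ restrict (inj₁ ∘ Inverse.to τ) (inj₁-varInjective (Injection.injective (↔⇒↣ τ)))

≼-DNNF : ∀ {n m n' m'} {G : Graph n m} {H : Graph n' m'} → Loopless G → H ≼ G →
  ∀ {s} → DNNFOf s (Tseitin0 G) → DNNFOf s (Tseitin0 H)
≼-DNNF {G = G} {H} _ (≼-iso I) = iso-DNNF G H I
≼-DNNF {G = G} ll (≼-delEdge e H≼G-e) = ≼-DNNF (ll ∘ punchIn e) H≼G-e ∘ delEdge-DNNF G e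
≼-DNNF {G = G} ll (≼-delVertex v iso H≼G-v) =
  ≼-DNNF (loopless-delVertex G v iso ll) H≼G-v ∘ DNNFOf-cong (Tseitin0-delVertex G v iso)
≼-DNNF {G = G} ll (≼-suppress v e₁ e₂ e₁≢e₂ deg≡2 v∈e₁ v∈e₂ p≢q iso H≼S-v) =
  ≼-DNNF (loopless-delVertex S v iso loopless-suppress) H≼S-v ∘ DNNFOf-cong (Tseitin0-delVertex S v iso) ∘ suppress-DNNF
  where open Suppression G ll v e₁ e₂ e₁≢e₂ deg≡2 v∈e₁ v∈e₂ p≢q

lemma11 : ∀ {n m n' m'} (G : Graph n m) (H : Graph n' m') → Loopless G → H ≼ G →
    (s : ℕ) → (D : DNNF m s) → Computes D (Tseitin0 G) →
    Σ ℕ λ s' → s' ≤ s × Σ (DNNF m' s') λ D' → Computes D' (Tseitin0 H)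
lemma11 G H ll H≼G s D D-G = s , ≤-refl , ≼-DNNF ll H≼G (D , D-G)
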